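{- For every finite simple graph $G$, the family of maximum critical independent sets of $G$ equals \[ \bigl\{S\in\Omega(L_G):E(S,L^c(G))=\emptyset\bigr\}. \]
   Context: For $X\subseteq V(G)$, $N(X)$ is the union of neighborhoods of the vertices of $X$. $\Omega(H)$ is the family of maximum independent sets of a graph $H$. An independent set $I$ of $G$ is critical if $|I|-|N(I)|\ge |J|-|N(J)|$ for every independent set $J$ of $G$; a maximum critical independent set is a critical independent set of maximum cardinality among critical independent sets. $L(G)$ denotes the set $J\cup N(J)$ for any maximum critical independent set $J$ of $G$ (this set does not depend on the choice of $J$); $L^c(G)=V(G)-L(G)$ and $L_G=G[L(G)]$. For $X,Y\subseteq V(G)$, $E(X,Y)$ is the set of edges $uv\in E(G)$ with $u\in X$, $v\in Y$. -}

module Defs where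

open import Data.Nat using (ℕ; _≤_)
open import Data.Integer as ℤ using (ℤ; +_; _-_)
open import Data.Fin using (Fin)
open import Data.Fin.Subset using (Subset; _∈_; _∉_; _⊆_; ∁; _∪_; ∣_∣)
open import Data.Fin.Subset.Properties using (_∈?_)
open import Data.Fin.Properties using (any?)
open import Data.Vec using (tabulate)
open import Data.Product using (_×_; _,_; ∃)
open import Relation.Nullary using (¬_; Dec)
open import Relation.Nullary.Decidable using (⌊_⌋; _×-dec_)
open import Data.Bool using (true; false)

record Graph (n : ℕ) : Set₁ where
  field
    Adj   : Fin n → Fin n → Set
    adj?  : ∀ u v → Dec (Adj u v)
    sym   : ∀ {u v} → Adj u v → Adj v u
    irrefl : ∀ {u} → ¬ Adj u u
open Graph public

module _ {n : ℕ} (G : Graph n) where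

  N : Subset n → Subset n
  N X = tabulate (λ v → ⌊ any? (λ u → (u ∈? X) ×-dec adj? G u v) ⌋)

  Independent : Subset n → Set
  Independent I = ∀ u v → u ∈ I → v ∈ I → ¬ Adj G u v

  diff : Subset n → ℤ
  diff I = + ∣ I ∣ - + ∣ N I ∣

  Critical : Subset n → Set
  Critical I = Independent I × (∀ J → Independent J → diff J ℤ.≤ diff I)

  MaxCritical : Subset n → Set
  MaxCritical I = Critical I × (∀ J → Critical J → ∣ J ∣ ≤ ∣ I ∣)

  -- S ∈ Ω(G[L]) : S is a maximum independent set of the induced subgraph G[L]
  -- (vertex subsets of G[L] are represented as subsets of V(G) contained in L;
  -- independence in G[L] of such a set is independence in G).
  MaximumIndependentIn : Subset n → Subset n → Set
  MaximumIndependentIn L S =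
    S ⊆ L × Independent S × (∀ T → T ⊆ L → Independent T → ∣ T ∣ ≤ ∣ S ∣)

  NoEdgesBetween : Subset n → Subset n → Set
  NoEdgesBetween X Y = ∀ u v → u ∈ X → v ∈ Y → ¬ Adj G u v

  -- L(G) = J ∪ N(J) for a maximum critical independent set J
  LSet : Subset n → Subset n
  LSet J = J ∪ N J

-- Write d X = |X| - |N X| and core X = X - N X.  The function d is supermodular on
-- all vertex sets, and core X is independent with d X ≤ d (core X); hence the critical
-- independent sets are exactly the independent maximisers of d over all vertex sets,
-- and maximisers are closed under union.  For J maximum critical and S critical,
-- J ∪ core (J ∪ S) is again critical independent, so core (J ∪ S) ⊆ J by maximality
-- of |J|, which forces S ⊆ L.  A neighbour of S outside L would be a neighbour of
-- J ∪ S that is neither in J ∪ S nor adjacent to its core, and every such vertex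
-- raises d (core (J ∪ S)) strictly above the maximum d (J ∪ S); so N S ⊆ L as well.
-- For independent T ⊆ L, the sets T and N (J - N T) are disjoint and lie in
-- (J - N T) ∪ N J, which together with d (J - N T) ≤ d J gives |T| ≤ |J| ≤ |S|.
-- Conversely, a maximum independent S of G[L] with N S ⊆ L has |J| ≤ |S| and
-- |S| + |N S| ≤ |L| = |J| + |N J|, hence d J ≤ d S.

{-# OPTIONS --safe #-}
module Submission where

open import Defs renaming (sym to adj-sym)
open import Data.Nat using (ℕ; suc; _+_; _≤_)
import Data.Nat.Properties as ℕ
open import Data.Nat.Tactic.RingSolver using (solve-∀)
open import Data.Integer as ℤ using (ℤ; +_; _-_; -_; +≤+)
import Data.Integer.Properties as ℤP
import Data.Integer.Tactic.RingSolver as ℤ-Solver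
open import Data.Fin.Subset
  using (Subset; inside; outside; ⊥; ⁅_⁆; ∁; _∈_; _∉_; _⊆_; _∪_; _∩_; ∣_∣)
open import Data.Fin.Subset.Properties
  using (_∈?_; x∈p∪q⁺; x∈p∪q⁻; p⊆p∪q; q⊆p∪q; x∈p∩q⁺; x∈p∩q⁻; p∩q⊆p; p∩q⊆q;
         x∈∁p⇒x∉p; x∉p⇒x∈∁p; x∈⁅y⁆⇒x≡y; ∣⁅x⁆∣≡1; ⊥⊆; ∣⊥∣≡0; Empty-unique;
         p⊆q⇒∣p∣≤∣q∣; p⊂q⇒∣p∣<∣q∣)
open import Data.Vec using ([]; _∷_)
open import Data.Vec.Properties using (lookup∘tabulate; []=⇒lookup; lookup⇒[]=)
open import Data.Bool.Properties using (T-≡)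
open import Data.Product using (_×_; _,_; ∃-syntax; proj₁; proj₂; uncurry)
open import Data.Sum as Sum using (inj₁; inj₂; [_,_])
open import Relation.Nullary using (yes; no; contradiction)
open import Relation.Nullary.Decidable using (toWitness; fromWitness)
open import Relation.Binary.PropositionalEquality
  using (_≡_; refl; sym; trans; cong; subst; module ≡-Reasoning)
open import Function using (_∘_)
open import Function.Bundles using (_⇔_; mk⇔; Equivalence)

private variable n : ℕ

Disjoint : Subset n → Subset n → Set
Disjoint p q = ∀ {x} → x ∈ p → x ∉ q

∪-⊆ : {p q r : Subset n} → p ⊆ r → q ⊆ r → p ∪ q ⊆ r
∪-⊆ {p = p} {q} p⊆r q⊆r x∈p∪q = [ p⊆r , q⊆r ] (x∈p∪q⁻ p q x∈p∪q)

∣p∪q∣+∣p∩q∣≡∣p∣+∣q∣ : ∀ (p q : Subset n) → ∣ p ∪ q ∣ + ∣ p ∩ q ∣ ≡ ∣ p ∣ + ∣ q ∣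
∣p∪q∣+∣p∩q∣≡∣p∣+∣q∣ []            []            = refl
∣p∪q∣+∣p∩q∣≡∣p∣+∣q∣ (inside  ∷ p) (inside  ∷ q) = begin
  suc (∣ p ∪ q ∣ + suc (∣ p ∩ q ∣)) ≡⟨ cong suc (ℕ.+-suc _ _) ⟩
  suc (suc (∣ p ∪ q ∣ + ∣ p ∩ q ∣))   ≡⟨ cong (suc ∘ suc) (∣p∪q∣+∣p∩q∣≡∣p∣+∣q∣ p q) ⟩
  suc (suc (∣ p ∣ + ∣ q ∣))           ≡⟨ cong suc (ℕ.+-suc _ _) ⟨
  suc (∣ p ∣ + suc (∣ q ∣))           ∎
  where open ≡-Reasoning
∣p∪q∣+∣p∩q∣≡∣p∣+∣q∣ (inside  ∷ p) (outside ∷ q) = cong suc (∣p∪q∣+∣p∩q∣≡∣p∣+∣q∣ p q)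
∣p∪q∣+∣p∩q∣≡∣p∣+∣q∣ (outside ∷ p) (inside  ∷ q) =
  trans (cong suc (∣p∪q∣+∣p∩q∣≡∣p∣+∣q∣ p q)) (sym (ℕ.+-suc _ _))
∣p∪q∣+∣p∩q∣≡∣p∣+∣q∣ (outside ∷ p) (outside ∷ q) = ∣p∪q∣+∣p∩q∣≡∣p∣+∣q∣ p q

∣p∪q∣≤∣p∣+∣q∣ : ∀ (p q : Subset n) → ∣ p ∪ q ∣ ≤ ∣ p ∣ + ∣ q ∣
∣p∪q∣≤∣p∣+∣q∣ p q =
  ℕ.≤-trans (ℕ.m≤m+n _ _) (ℕ.≤-reflexive (∣p∪q∣+∣p∩q∣≡∣p∣+∣q∣ p q))

disjoint⇒∣p∪q∣≡∣p∣+∣q∣ : ∀ {p q : Subset n} → Disjoint p q → ∣ p ∪ q ∣ ≡ ∣ p ∣ + ∣ q ∣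
disjoint⇒∣p∪q∣≡∣p∣+∣q∣ {n} {p} {q} p∩q=∅ = begin
  ∣ p ∪ q ∣                 ≡⟨ ℕ.+-identityʳ _ ⟨
  ∣ p ∪ q ∣ + 0             ≡⟨ cong (λ m → ∣ p ∪ q ∣ + m) ∣p∩q∣≡0 ⟨
  ∣ p ∪ q ∣ + ∣ p ∩ q ∣     ≡⟨ ∣p∪q∣+∣p∩q∣≡∣p∣+∣q∣ p q ⟩
  ∣ p ∣ + ∣ q ∣             ∎
  where
  open ≡-Reasoning
  ∣p∩q∣≡0 : ∣ p ∩ q ∣ ≡ 0
  ∣p∩q∣≡0 = trans (cong ∣_∣ (Empty-unique λ (_ , x∈p∩q) →
    let (x∈p , x∈q) = x∈p∩q⁻ p q x∈p∩q in p∩q=∅ x∈p x∈q)) (∣⊥∣≡0 n)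

p⊆q∧∣q∣≤∣p∣⇒q⊆p : {p q : Subset n} → p ⊆ q → ∣ q ∣ ≤ ∣ p ∣ → q ⊆ p
p⊆q∧∣q∣≤∣p∣⇒q⊆p {p = p} p⊆q ∣q∣≤∣p∣ {x} x∈q with x ∈? p
... | yes x∈p = x∈p
... | no  x∉p = contradiction (p⊂q⇒∣p∣<∣q∣ (p⊆q , x , x∈q , x∉p)) (ℕ.≤⇒≯ ∣q∣≤∣p∣)

⁅x⁆⊆ : ∀ {x} {p : Subset n} → x ∈ p → ⁅ x ⁆ ⊆ p
⁅x⁆⊆ {x = x} x∈p y∈⁅x⁆ = subst (_∈ _) (sym (x∈⁅y⁆⇒x≡y x y∈⁅x⁆)) x∈p

[m-o]+[n-p]≡[m+n]-[o+p] : ∀ m n o p → (+ m - + o) ℤ.+ (+ n - + p) ≡ + (m + n) - + (o + p)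
[m-o]+[n-p]≡[m+n]-[o+p] m n o p = identity (+ m) (+ n) (+ o) (+ p)
  where
  identity : ∀ (a b c d : ℤ) → (a - c) ℤ.+ (b - d) ≡ (a ℤ.+ b) - (c ℤ.+ d)
  identity = ℤ-Solver.solve-∀

m-n≤o-p⇔m+p≤o+n : ∀ {m n o p} → + m - + n ℤ.≤ + o - + p ⇔ m + p ≤ o + n
m-n≤o-p⇔m+p≤o+n {m} {n} {o} {p} = mk⇔ to from
  where
  open ℤP.≤-Reasoning
  shift : ∀ (x y z : ℤ) → x ℤ.+ z ≡ (x - y) ℤ.+ (y ℤ.+ z)
  shift = ℤ-Solver.solve-∀
  unshift : ∀ (x y z : ℤ) → (x - z) ℤ.+ (y ℤ.+ z) ≡ x ℤ.+ y
  unshift = ℤ-Solver.solve-∀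
  extend : ∀ (x y z : ℤ) → x - y ≡ (x ℤ.+ z) - (y ℤ.+ z)
  extend = ℤ-Solver.solve-∀
  cancel : ∀ (x y z : ℤ) → (x ℤ.+ y) - (y ℤ.+ z) ≡ x - z
  cancel = ℤ-Solver.solve-∀
  to : + m - + n ℤ.≤ + o - + p → m + p ≤ o + n
  to h = ℤP.drop‿+≤+ (begin
    + m ℤ.+ + p                     ≡⟨ shift (+ m) (+ n) (+ p) ⟩
    (+ m - + n) ℤ.+ (+ n ℤ.+ + p)   ≤⟨ ℤP.+-monoˡ-≤ (+ n ℤ.+ + p) h ⟩
    (+ o - + p) ℤ.+ (+ n ℤ.+ + p)   ≡⟨ unshift (+ o) (+ n) (+ p) ⟩
    + o ℤ.+ + n                     ∎)
  from : m + p ≤ o + n → + m - + n ℤ.≤ + o - + p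
  from h = begin
    + m - + n                       ≡⟨ extend (+ m) (+ n) (+ p) ⟩
    (+ m ℤ.+ + p) - (+ n ℤ.+ + p)   ≤⟨ ℤP.+-monoˡ-≤ (- (+ n ℤ.+ + p)) (+≤+ h) ⟩
    (+ o ℤ.+ + n) - (+ n ℤ.+ + p)   ≡⟨ cancel (+ o) (+ n) (+ p) ⟩
    + o - + p                       ∎

+-cancelˡ-≤ : ∀ i {j k} → i ℤ.+ j ℤ.≤ i ℤ.+ k → j ℤ.≤ k
+-cancelˡ-≤ i {j} {k} h = begin
  j                    ≡⟨ cancel i j ⟨
  - i ℤ.+ (i ℤ.+ j)    ≤⟨ ℤP.+-monoʳ-≤ (- i) h ⟩
  - i ℤ.+ (i ℤ.+ k)    ≡⟨ cancel i k ⟩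
  k                    ∎
  where
  open ℤP.≤-Reasoning
  cancel : ∀ (x y : ℤ) → - x ℤ.+ (x ℤ.+ y) ≡ y
  cancel = ℤ-Solver.solve-∀

module _ {n : ℕ} (G : Graph n) where

  ∈N⁻ : ∀ {X v} → v ∈ N G X → ∃[ u ] u ∈ X × Adj G u v
  ∈N⁻ {X} {v} v∈NX = toWitness (Equivalence.from T-≡
    (trans (sym (lookup∘tabulate _ v)) ([]=⇒lookup v∈NX)))

  ∈N⁺ : ∀ {X u v} → u ∈ X → Adj G u v → v ∈ N G X
  ∈N⁺ {X} {u} {v} u∈X uv = lookup⇒[]= v (N G X)
    (trans (lookup∘tabulate _ v) (Equivalence.to T-≡ (fromWitness (u , u∈X , uv))))

  N-mono : ∀ {X Y} → X ⊆ Y → N G X ⊆ N G Y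
  N-mono X⊆Y v∈NX = let (u , u∈X , uv) = ∈N⁻ v∈NX in ∈N⁺ (X⊆Y u∈X) uv

  N-∪ : ∀ X Y → N G (X ∪ Y) ⊆ N G X ∪ N G Y
  N-∪ X Y v∈N[X∪Y] = let (u , u∈X∪Y , uv) = ∈N⁻ v∈N[X∪Y] in
    x∈p∪q⁺ (Sum.map (λ u∈X → ∈N⁺ u∈X uv) (λ u∈Y → ∈N⁺ u∈Y uv) (x∈p∪q⁻ X Y u∈X∪Y))

  N-∩ : ∀ X Y → N G (X ∩ Y) ⊆ N G X ∩ N G Y
  N-∩ X Y v∈N[X∩Y] = x∈p∩q⁺ (N-mono (p∩q⊆p X Y) v∈N[X∩Y] , N-mono (p∩q⊆q X Y) v∈N[X∩Y])

  independent⇒disjoint-N : ∀ {X} → Independent G X → Disjoint X (N G X)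
  independent⇒disjoint-N indX v∈X v∈NX =
    let (u , u∈X , uv) = ∈N⁻ v∈NX in indX u _ u∈X v∈X uv

  independent-⊆ : ∀ {X Y} → Y ⊆ X → Independent G X → Independent G Y
  independent-⊆ Y⊆X indX u v u∈Y v∈Y = indX u v (Y⊆X u∈Y) (Y⊆X v∈Y)

  independent-∪ : ∀ {X Y} → Independent G X → Independent G Y → Disjoint Y (N G X) →
                  Independent G (X ∪ Y)
  independent-∪ {X} {Y} indX indY Y∩NX=∅ u v u∈X∪Y v∈X∪Y uv
    with x∈p∪q⁻ X Y u∈X∪Y | x∈p∪q⁻ X Y v∈X∪Y
  ... | inj₁ u∈X | inj₁ v∈X = indX u v u∈X v∈X uv
  ... | inj₁ u∈X | inj₂ v∈Y = Y∩NX=∅ v∈Y (∈N⁺ u∈X uv)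
  ... | inj₂ u∈Y | inj₁ v∈X = Y∩NX=∅ u∈Y (∈N⁺ v∈X (adj-sym G uv))
  ... | inj₂ u∈Y | inj₂ v∈Y = indY u v u∈Y v∈Y uv

  MaximisesDiff : Subset n → Set
  MaximisesDiff X = ∀ Y → diff G Y ℤ.≤ diff G X

  diff-supermodular : ∀ X Y → diff G X ℤ.+ diff G Y ℤ.≤ diff G (X ∪ Y) ℤ.+ diff G (X ∩ Y)
  diff-supermodular X Y = begin
    diff G X ℤ.+ diff G Y
      ≡⟨ [m-o]+[n-p]≡[m+n]-[o+p] (∣ X ∣) (∣ Y ∣) (∣ N G X ∣) (∣ N G Y ∣) ⟩
    + (∣ X ∣ + ∣ Y ∣) - + (∣ N G X ∣ + ∣ N G Y ∣)
      ≡⟨ cong (λ m → + m - + (∣ N G X ∣ + ∣ N G Y ∣)) (∣p∪q∣+∣p∩q∣≡∣p∣+∣q∣ X Y) ⟨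
    + (∣ X ∪ Y ∣ + ∣ X ∩ Y ∣) - + (∣ N G X ∣ + ∣ N G Y ∣)
      ≤⟨ ℤP.+-monoʳ-≤ (+ (∣ X ∪ Y ∣ + ∣ X ∩ Y ∣)) (ℤP.neg-mono-≤ (+≤+ neighbours)) ⟩
    + (∣ X ∪ Y ∣ + ∣ X ∩ Y ∣) - + (∣ N G (X ∪ Y) ∣ + ∣ N G (X ∩ Y) ∣)
      ≡⟨ [m-o]+[n-p]≡[m+n]-[o+p] (∣ X ∪ Y ∣) (∣ X ∩ Y ∣) (∣ N G (X ∪ Y) ∣) (∣ N G (X ∩ Y) ∣) ⟨
    diff G (X ∪ Y) ℤ.+ diff G (X ∩ Y) ∎
    where
    open ℤP.≤-Reasoning
    neighbours : ∣ N G (X ∪ Y) ∣ + ∣ N G (X ∩ Y) ∣ ≤ ∣ N G X ∣ + ∣ N G Y ∣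
    neighbours = ℕ.≤-trans (ℕ.+-mono-≤ (p⊆q⇒∣p∣≤∣q∣ (N-∪ X Y)) (p⊆q⇒∣p∣≤∣q∣ (N-∩ X Y)))
                           (ℕ.≤-reflexive (∣p∪q∣+∣p∩q∣≡∣p∣+∣q∣ (N G X) (N G Y)))

  maximisesDiff-∪ : ∀ {X Y} → MaximisesDiff X → MaximisesDiff Y → MaximisesDiff (X ∪ Y)
  maximisesDiff-∪ {X} {Y} maxX maxY Z = ℤP.≤-trans (maxX Z) (+-cancelˡ-≤ (diff G Y) (begin
    diff G Y ℤ.+ diff G X               ≡⟨ ℤP.+-comm (diff G Y) (diff G X) ⟩
    diff G X ℤ.+ diff G Y               ≤⟨ diff-supermodular X Y ⟩
    diff G (X ∪ Y) ℤ.+ diff G (X ∩ Y)   ≤⟨ ℤP.+-monoʳ-≤ (diff G (X ∪ Y)) (maxY (X ∩ Y)) ⟩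
    diff G (X ∪ Y) ℤ.+ diff G Y         ≡⟨ ℤP.+-comm (diff G (X ∪ Y)) (diff G Y) ⟩
    diff G Y ℤ.+ diff G (X ∪ Y)         ∎))
    where open ℤP.≤-Reasoning

  core : Subset n → Subset n
  core X = X ∩ ∁ (N G X)

  core⊆ : ∀ X → core X ⊆ X
  core⊆ X = p∩q⊆p X (∁ (N G X))

  core∩N=∅ : ∀ X → Disjoint (core X) (N G X)
  core∩N=∅ X = x∈∁p⇒x∉p ∘ p∩q⊆q X (∁ (N G X))

  core-independent : ∀ X → Independent G (core X)
  core-independent X u v u∈I v∈I uv = core∩N=∅ X v∈I (∈N⁺ (core⊆ X u∈I) uv)

  ∣X∣≤∣core∣+∣X∩N∣ : ∀ X → ∣ X ∣ ≤ ∣ core X ∣ + ∣ X ∩ N G X ∣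
  ∣X∣≤∣core∣+∣X∩N∣ X = ℕ.≤-trans (p⊆q⇒∣p∣≤∣q∣ X⊆I∪D) (∣p∪q∣≤∣p∣+∣q∣ (core X) (X ∩ N G X))
    where
    X⊆I∪D : X ⊆ core X ∪ X ∩ N G X
    X⊆I∪D {x} x∈X with x ∈? N G X
    ... | yes x∈NX = q⊆p∪q (core X) _ (x∈p∩q⁺ (x∈X , x∈NX))
    ... | no  x∉NX = p⊆p∪q _ (x∈p∩q⁺ (x∈X , x∉p⇒x∈∁p x∉NX))

  ∣N[core]∣+∣X∩N∣+∣E∣≤∣N∣ : ∀ X E → E ⊆ N G X ∩ ∁ (X ∪ N G (core X)) →
                            ∣ N G (core X) ∣ + ∣ X ∩ N G X ∣ + ∣ E ∣ ≤ ∣ N G X ∣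
  ∣N[core]∣+∣X∩N∣+∣E∣≤∣N∣ X E E⊆ = begin
    ∣ N G I ∣ + ∣ D ∣ + ∣ E ∣   ≡⟨ cong (λ m → m + ∣ E ∣) (disjoint⇒∣p∪q∣≡∣p∣+∣q∣ NI∩D=∅) ⟨
    ∣ N G I ∪ D ∣ + ∣ E ∣       ≡⟨ disjoint⇒∣p∪q∣≡∣p∣+∣q∣ [NI∪D]∩E=∅ ⟨
    ∣ (N G I ∪ D) ∪ E ∣         ≤⟨ p⊆q⇒∣p∣≤∣q∣ (∪-⊆ (∪-⊆ (N-mono (core⊆ X)) (p∩q⊆q X _))
                                                    (p∩q⊆p _ _ ∘ E⊆)) ⟩
    ∣ N G X ∣                   ∎
    where
    open ℕ.≤-Reasoning
    I : Subset n
    I = core X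
    D : Subset n
    D = X ∩ N G X

    NI∩D=∅ : Disjoint (N G I) D
    NI∩D=∅ y∈NI y∈D = let (c , c∈I , cy) = ∈N⁻ y∈NI in
      core∩N=∅ X c∈I (∈N⁺ (p∩q⊆p X (N G X) y∈D) (adj-sym G cy))

    [NI∪D]∩E=∅ : Disjoint (N G I ∪ D) E
    [NI∪D]∩E=∅ z∈NI∪D z∈E = x∈∁p⇒x∉p (p∩q⊆q _ _ (E⊆ z∈E))
      ([ q⊆p∪q X _ , p⊆p∪q _ ∘ p∩q⊆p X (N G X) ] (x∈p∪q⁻ _ D z∈NI∪D))

  core-gain : ∀ X E → E ⊆ N G X ∩ ∁ (X ∪ N G (core X)) →
              diff G X ℤ.+ + ∣ E ∣ ℤ.≤ diff G (core X)
  core-gain X E E⊆ = subst (ℤ._≤ diff G I) (sym (move (+ ∣ X ∣) (+ ∣ N G X ∣) (+ ∣ E ∣)))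
    (Equivalence.from (m-n≤o-p⇔m+p≤o+n {∣ X ∣ + ∣ E ∣} {∣ N G X ∣} {∣ I ∣} {∣ N G I ∣}) (begin
      ∣ X ∣ + ∣ E ∣ + ∣ N G I ∣               ≤⟨ ℕ.+-monoˡ-≤ (∣ N G I ∣)
                                                   (ℕ.+-monoˡ-≤ (∣ E ∣) (∣X∣≤∣core∣+∣X∩N∣ X)) ⟩
      ∣ I ∣ + ∣ D ∣ + ∣ E ∣ + ∣ N G I ∣       ≡⟨ regroup (∣ I ∣) (∣ D ∣) (∣ E ∣) (∣ N G I ∣) ⟩
      ∣ I ∣ + (∣ N G I ∣ + ∣ D ∣ + ∣ E ∣)     ≤⟨ ℕ.+-monoʳ-≤ (∣ I ∣)
                                                   (∣N[core]∣+∣X∩N∣+∣E∣≤∣N∣ X E E⊆) ⟩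
      ∣ I ∣ + ∣ N G X ∣                       ∎))
    where
    open ℕ.≤-Reasoning
    I : Subset n
    I = core X
    D : Subset n
    D = X ∩ N G X
    move : ∀ (a b e : ℤ) → (a - b) ℤ.+ e ≡ (a ℤ.+ e) - b
    move = ℤ-Solver.solve-∀
    regroup : ∀ i d e m → i + d + e + m ≡ i + (m + d + e)
    regroup = solve-∀

  diff≤diff-core : ∀ X → diff G X ℤ.≤ diff G (core X)
  diff≤diff-core X = ℤP.≤-trans (ℤP.i≤i+j _ _) (core-gain X ⊥ ⊥⊆)

  critical⇒maximisesDiff : ∀ {I} → Critical G I → MaximisesDiff I
  critical⇒maximisesDiff (_ , critI) Y =
    ℤP.≤-trans (diff≤diff-core Y) (critI (core Y) (core-independent Y))

  module _ {J : Subset n} (maxCritJ : MaxCritical G J) where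

    private
      critJ : Critical G J
      critJ = proj₁ maxCritJ

      indJ : Independent G J
      indJ = proj₁ critJ

      maxDiffJ : MaximisesDiff J
      maxDiffJ = critical⇒maximisesDiff critJ

      maxDiff-J∪ : ∀ {S} → Critical G S → MaximisesDiff (J ∪ S)
      maxDiff-J∪ critS = maximisesDiff-∪ maxDiffJ (critical⇒maximisesDiff critS)

    core-J∪⊆J : ∀ {S} → Critical G S → core (J ∪ S) ⊆ J
    core-J∪⊆J {S} critS = p⊆q∧∣q∣≤∣p∣⇒q⊆p (p⊆p∪q P) (proj₂ maxCritJ (J ∪ P) critJ∪P) ∘ q⊆p∪q J P
      where
      U : Subset n
      U = J ∪ S
      P : Subset n
      P = core U

      P∩NJ=∅ : Disjoint P (N G J)
      P∩NJ=∅ p∈P p∈NJ = core∩N=∅ U p∈P (N-mono (p⊆p∪q S) p∈NJ)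

      maxDiffP : MaximisesDiff P
      maxDiffP Y = ℤP.≤-trans (maxDiff-J∪ critS Y) (diff≤diff-core U)

      critJ∪P : Critical G (J ∪ P)
      critJ∪P = independent-∪ indJ (core-independent U) P∩NJ=∅
              , λ K _ → maximisesDiff-∪ maxDiffJ maxDiffP K

    critical⊆L : ∀ {S} → Critical G S → S ⊆ LSet G J
    critical⊆L {S} critS {s} s∈S with s ∈? N G J
    ... | yes s∈NJ = q⊆p∪q J (N G J) s∈NJ
    ... | no  s∉NJ = p⊆p∪q (N G J) (core-J∪⊆J critS (x∈p∩q⁺ (q⊆p∪q J S s∈S , x∉p⇒x∈∁p s∉NU)))
      where
      s∉NU : s ∉ N G (J ∪ S)
      s∉NU s∈NU = [ s∉NJ , independent⇒disjoint-N (proj₁ critS) s∈S ] (x∈p∪q⁻ _ _ (N-∪ J S s∈NU))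

    N-critical⊆L : ∀ {S} → Critical G S → N G S ⊆ LSet G J
    N-critical⊆L {S} critS {v} v∈NS with v ∈? LSet G J
    ... | yes v∈L = v∈L
    ... | no  v∉L = contradiction (ℤP.drop‿+≤+ (+-cancelˡ-≤ (diff G U) gain)) λ ()
      where
      open ℤP.≤-Reasoning
      U : Subset n
      U = J ∪ S

      v∉U∪N[coreU] : v ∉ U ∪ N G (core U)
      v∉U∪N[coreU] h = v∉L ([ [ p⊆p∪q (N G J) , critical⊆L critS ] ∘ x∈p∪q⁻ J S
                             , q⊆p∪q J (N G J) ∘ N-mono (core-J∪⊆J critS) ] (x∈p∪q⁻ U _ h))

      gain : diff G U ℤ.+ + 1 ℤ.≤ diff G U ℤ.+ + 0
      gain = begin
        diff G U ℤ.+ + 1            ≡⟨ cong (λ m → diff G U ℤ.+ + m) (∣⁅x⁆∣≡1 v) ⟨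
        diff G U ℤ.+ + ∣ ⁅ v ⁆ ∣    ≤⟨ core-gain U ⁅ v ⁆ (⁅x⁆⊆ (x∈p∩q⁺
                                         (N-mono (q⊆p∪q J S) v∈NS , x∉p⇒x∈∁p v∉U∪N[coreU]))) ⟩
        diff G (core U)             ≤⟨ maxDiff-J∪ critS (core U) ⟩
        diff G U                    ≡⟨ ℤP.+-identityʳ (diff G U) ⟨
        diff G U ℤ.+ + 0            ∎

    independent⊆L⇒∣T∣≤∣J∣ : ∀ {T} → T ⊆ LSet G J → Independent G T → ∣ T ∣ ≤ ∣ J ∣
    independent⊆L⇒∣T∣≤∣J∣ {T} T⊆L indT =
      ℕ.+-cancelʳ-≤ (∣ N G K ∣) (∣ T ∣) (∣ J ∣) (ℕ.≤-trans T+NK≤K+NJ K+NJ≤J+NK)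
      where
      open ℕ.≤-Reasoning
      K : Subset n
      K = J ∩ ∁ (N G T)

      K+NJ≤J+NK : ∣ K ∣ + ∣ N G J ∣ ≤ ∣ J ∣ + ∣ N G K ∣
      K+NJ≤J+NK = Equivalence.to (m-n≤o-p⇔m+p≤o+n {∣ K ∣} {∣ N G K ∣} {∣ J ∣} {∣ N G J ∣})
                    (proj₂ critJ K (independent-⊆ (p∩q⊆p J _) indJ))

      T∩NK=∅ : Disjoint T (N G K)
      T∩NK=∅ t∈T t∈NK = let (k , k∈K , kt) = ∈N⁻ t∈NK in
        x∈∁p⇒x∉p (p∩q⊆q J _ k∈K) (∈N⁺ t∈T (adj-sym G kt))

      T⊆K∪NJ : T ⊆ K ∪ N G J
      T⊆K∪NJ t∈T = x∈p∪q⁺ (Sum.map₁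
        (λ t∈J → x∈p∩q⁺ (t∈J , x∉p⇒x∈∁p (independent⇒disjoint-N indT t∈T)))
        (x∈p∪q⁻ J _ (T⊆L t∈T)))

      T+NK≤K+NJ : ∣ T ∣ + ∣ N G K ∣ ≤ ∣ K ∣ + ∣ N G J ∣
      T+NK≤K+NJ = begin
        ∣ T ∣ + ∣ N G K ∣    ≡⟨ disjoint⇒∣p∪q∣≡∣p∣+∣q∣ T∩NK=∅ ⟨
        ∣ T ∪ N G K ∣        ≤⟨ p⊆q⇒∣p∣≤∣q∣ (∪-⊆ T⊆K∪NJ (q⊆p∪q K _ ∘ N-mono (p∩q⊆p J _))) ⟩
        ∣ K ∪ N G J ∣        ≤⟨ ∣p∪q∣≤∣p∣+∣q∣ K (N G J) ⟩
        ∣ K ∣ + ∣ N G J ∣    ∎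

    maxCritical⇒maximumIndependentInL :
      ∀ {S} → MaxCritical G S →
      MaximumIndependentIn G (LSet G J) S × NoEdgesBetween G S (∁ (LSet G J))
    maxCritical⇒maximumIndependentInL {S} (critS , maxS) =
        (critical⊆L critS , proj₁ critS , λ T T⊆L indT →
           ℕ.≤-trans (independent⊆L⇒∣T∣≤∣J∣ T⊆L indT) (maxS J critJ))
      , λ u v u∈S v∈∁L uv → x∈∁p⇒x∉p v∈∁L (N-critical⊆L critS (∈N⁺ u∈S uv))

    maximumIndependentInL⇒maxCritical :
      ∀ {S} → MaximumIndependentIn G (LSet G J) S → NoEdgesBetween G S (∁ (LSet G J)) →
      MaxCritical G S
    maximumIndependentInL⇒maxCritical {S} (S⊆L , indS , maxS) noEdges =
        (indS , λ K indK → ℤP.≤-trans (proj₂ critJ K indK) diffJ≤diffS)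
      , λ K critK → ℕ.≤-trans (proj₂ maxCritJ K critK) ∣J∣≤∣S∣
      where
      open ℕ.≤-Reasoning
      L : Subset n
      L = LSet G J

      ∣J∣≤∣S∣ : ∣ J ∣ ≤ ∣ S ∣
      ∣J∣≤∣S∣ = maxS J (p⊆p∪q (N G J)) indJ

      NS⊆L : N G S ⊆ L
      NS⊆L {v} v∈NS with v ∈? L
      ... | yes v∈L = v∈L
      ... | no  v∉L = let (u , u∈S , uv) = ∈N⁻ v∈NS in
        contradiction uv (noEdges u v u∈S (x∉p⇒x∈∁p v∉L))

      S+NS≤J+NJ : ∣ S ∣ + ∣ N G S ∣ ≤ ∣ J ∣ + ∣ N G J ∣
      S+NS≤J+NJ = begin
        ∣ S ∣ + ∣ N G S ∣    ≡⟨ disjoint⇒∣p∪q∣≡∣p∣+∣q∣ (independent⇒disjoint-N indS) ⟨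
        ∣ S ∪ N G S ∣        ≤⟨ p⊆q⇒∣p∣≤∣q∣ (∪-⊆ S⊆L NS⊆L) ⟩
        ∣ L ∣                ≤⟨ ∣p∪q∣≤∣p∣+∣q∣ J (N G J) ⟩
        ∣ J ∣ + ∣ N G J ∣    ∎

      diffJ≤diffS : diff G J ℤ.≤ diff G S
      diffJ≤diffS =
        Equivalence.from (m-n≤o-p⇔m+p≤o+n {∣ J ∣} {∣ N G J ∣} {∣ S ∣} {∣ N G S ∣}) (begin
          ∣ J ∣ + ∣ N G S ∣    ≤⟨ ℕ.+-monoˡ-≤ (∣ N G S ∣) ∣J∣≤∣S∣ ⟩
          ∣ S ∣ + ∣ N G S ∣    ≤⟨ S+NS≤J+NJ ⟩
          ∣ J ∣ + ∣ N G J ∣    ≤⟨ ℕ.+-monoˡ-≤ (∣ N G J ∣) ∣J∣≤∣S∣ ⟩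
          ∣ S ∣ + ∣ N G J ∣    ∎)

mainTheorem3 : ∀ (n : ℕ) (G : Graph n) (J : Subset n) → MaxCritical G J →
    ∀ (S : Subset n) →
      MaxCritical G S ⇔
        (MaximumIndependentIn G (LSet G J) S × NoEdgesBetween G S (∁ (LSet G J)))
mainTheorem3 n G J maxCritJ S =
  mk⇔ (maxCritical⇒maximumIndependentInL G maxCritJ)
      (uncurry (maximumIndependentInL⇒maxCritical G maxCritJ))
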